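{- Let $\mathcal{M}=(n,Q,\Sigma,\Gamma,\Delta,q_0,\gamma_0,F)$ be an OMPA (in normal form) with $n>1$. Then it is possible to construct a GPA $\mathcal{P}=(P,\Sigma',\Gamma,\delta,p_0,\bot,\{p_f\})$ with $P=Q\cup\{p_0,p_f\}$ (where $p_0,p_f\notin Q$) and $\Sigma'=\emptyset$ such that: (1) $L(\mathcal{M})\neq\emptyset$ if and only if $L(\mathcal{P})\neq\emptyset$; and (2) for every $p_1,p_2\in P$ and $\gamma\in\Gamma$ there is an $(n-1)$-OMPA $\mathcal{M}_{(p_1,\gamma,p_2)}$ with input alphabet $\Gamma$ such that $L(\mathcal{M}_{(p_1,\gamma,p_2)}) = (\delta(p_1,\gamma,\epsilon,p_2))^R$ and $|\mathcal{M}_{(p_1,\gamma,p_2)}| = O(|\mathcal{M}|^2)$.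
   Context: For a finite alphabet $X$, $X_\epsilon=X\cup\{\epsilon\}$; for a language $L$, $L^R=\{u^R : u\in L\}$ where $u^R$ is the mirror (reversal) of $u$. A multi-pushdown automaton (MPA) is $\mathcal{M}=(n,Q,\Sigma,\Gamma,\Delta,q_0,\gamma_0,F)$ with $n\ge1$ stacks, finite nonempty state set $Q$, finite input alphabet $\Sigma$, finite stack alphabet $\Gamma\ni\bot$, $q_0\in Q$, $\gamma_0\in\Gamma\setminus\{\bot\}$, $F\subseteq Q$, and $\Delta\subseteq(Q\times(\Gamma_\epsilon)^n)\times\Sigma_\epsilon\times(Q\times(\Gamma^*)^n)$ such that for each transition $((q,\gamma_1,\dots,\gamma_n),a,(q',\alpha_1,\dots,\alpha_n))$ and each $i$: $|\alpha_i|\le2$; if $\gamma_i\ne\bot$ then $\alpha_i\in(\Gamma\setminus\{\bot\})^*$; if $\gamma_i=\bot$ then $\alpha_i=\alpha_i'\bot$ with $\alpha_i'\in(\Gamma\setminus\{\bot\})\cup\{\epsilon\}$. $|\mathcal{M}|=n+|Q|+|\Sigma|+|\Gamma|+|\Delta|$. $\mathit{Stack}(\mathcal{M})=(\Gamma\setminus\{\bot\})^*\bot$; configurations are $(q,w_1,\dots,w_n)$ with $w_i\in\mathit{Stack}(\mathcal{M})$; each transition gives steps $(q,\gamma_1w_1,\dots,\gamma_nw_n)\xrightarrow{a}(q',\alpha_1w_1,\dots,\alpha_nw_n)$ whenever $\gamma_iw_i\in\mathit{Stack}(\mathcal{M})$. $L(\mathcal{M})$ is the set of $\tau\in\Sigma^*$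 labelling a finite sequence of steps from $(q_0,\gamma_0\bot,\bot,\dots,\bot)$ to a configuration with state in $F$ and all stacks equal to $\bot$. An OMPA is an MPA where each transition has, for some $i$, $\gamma_1=\dots=\gamma_{i-1}=\bot$, $\gamma_i\in\Gamma_\epsilon$, $\gamma_{i+1}=\dots=\gamma_n=\epsilon$; an $n$-OMPA has $n$ stacks. Normal form: every transition is either (a) $((q,\gamma,\epsilon,\dots,\epsilon),a,(q',\alpha_1,\dots,\alpha_n))$ with $\gamma\in\Gamma$, $\alpha_1\in\Gamma^*$, $\alpha_j\in(\Gamma\setminus\{\bot\})\cup\{\epsilon\}$ for $j\ge2$, or (b) a transition popping $\gamma\in\Gamma\setminus\{\bot\}$ from stack $i\in[2,n]$ (stacks $1..i-1$ read $\bot$, the rest $\epsilon$) and producing $\gamma'\bot$ on stack 1 ($\gamma'\in\Gamma\setminus\{\bot\}$), $\bot$ on stacks $2..i-1$, $\epsilon$ on stacks $i..n$. The paper assumes throughout that all OMPAs are in normal form. A generalized pushdown automaton (GPA) is $\mathcal{P}=(P,\Sigma',\Gamma,\delta,p_0,\gamma_0,F)$ with finite state set $P$, input alphabet $\Sigma'$, stack alphabet $\Gamma$, $\delta:P\times\Gamma\times\Sigma'_\epsilon\times P\to 2^{\Gamma^*}$, initial state $p_0$, initial stack symbol $\gamma_0$, final states $F$; configurations $(p,w)\in P\times\Gamma^*$; steps $(p,\gamma w)\xrightarrow{a}(p',uw)$ for $u\in\delta(p,\gamma,a,p')$; $L(\mathcal{P})$ is the set of words labelling finite step sequences from $(p_0,\gamma_0)$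 to some $(p,\epsilon)$ with $p\in F$. -}

module Defs where

open import Data.Nat using (ℕ; zero; suc; _+_; _*_; _≤_; _<_)
open import Data.Fin using (Fin; toℕ)
open import Data.Maybe using (Maybe; just; nothing)
open import Data.List using (List; []; _∷_; _++_; length)
open import Data.List.Relation.Unary.All using (All)
open import Data.List.Relation.Unary.Unique.Propositional using (Unique)
open import Data.List.Membership.Propositional using (_∈_)
open import Data.Vec using (Vec; lookup; zipWith; replicate) renaming (_∷_ to _∷v_)
open import Data.Product using (Σ; ∃; _×_; _,_)
open import Data.Sum using (_⊎_)
open import Relation.Binary.PropositionalEquality using (_≡_; _≢_)

-- Q = Fin nQ, Σ = Fin nΣ, Γ = Fin nΓ (with a
-- designated bottom symbol ⊥ = bot), and the number of stacks is
-- n = suc k (so n ≥ 1).  ε-components are modelled by 'nothing'.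

record Trans (n nQ nΣ nΓ : ℕ) : Set where
  constructor trans
  field
    src  : Fin nQ
    pop  : Vec (Maybe (Fin nΓ)) n
    lab  : Maybe (Fin nΣ)
    tgt  : Fin nQ
    push : Vec (List (Fin nΓ)) n

WFStack : {nΓ : ℕ} → Fin nΓ → Maybe (Fin nΓ) → List (Fin nΓ) → Set
WFStack bot γ α =
  (length α ≤ 2)
  × (γ ≢ just bot → All (λ x → x ≢ bot) α)
  × (γ ≡ just bot → Σ (List _) λ α' →
        (α ≡ α' ++ (bot ∷ [])) × (length α' ≤ 1) × All (λ x → x ≢ bot) α')

WFTrans : {n nQ nΣ nΓ : ℕ} → Fin nΓ → Trans n nQ nΣ nΓ → Set
WFTrans bot t = ∀ i → WFStack bot (lookup (Trans.pop t) i) (lookup (Trans.push t) i)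

record MPA (k nΣ : ℕ) : Set where
  field
    nQ    : ℕ
    nΓ    : ℕ
    bot   : Fin nΓ
    γ₀    : Fin nΓ
    γ₀≢bot : γ₀ ≢ bot
    q₀    : Fin nQ
    F     : List (Fin nQ)
    Δ     : List (Trans (suc k) nQ nΣ nΓ)
    Δ-unique : Unique Δ
    Δ-wf  : All (WFTrans bot) Δ

open MPA public

size : {k nΣ : ℕ} → MPA k nΣ → ℕ
size {k} {nΣ} M = suc k + nQ M + nΣ + nΓ M + length (Δ M)

IsStack : {nΓ : ℕ} → Fin nΓ → List (Fin nΓ) → Set
IsStack bot w = Σ (List _) λ u → (w ≡ u ++ (bot ∷ [])) × All (λ x → x ≢ bot) u

pre : {A : Set} → Maybe A → List A
pre nothing  = []
pre (just a) = a ∷ []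

Config : {k nΣ : ℕ} → MPA k nΣ → Set
Config {k} M = Fin (nQ M) × Vec (List (Fin (nΓ M))) (suc k)

data Step {k nΣ : ℕ} (M : MPA k nΣ) : Config M → Maybe (Fin nΣ) → Config M → Set where
  step : {t : Trans (suc k) (nQ M) nΣ (nΓ M)} → t ∈ Δ M →
         (ws : Vec (List (Fin (nΓ M))) (suc k)) →
         (∀ i → IsStack (bot M) (pre (lookup (Trans.pop t) i) ++ lookup ws i)) →
         Step M (Trans.src t , zipWith (λ g w → pre g ++ w) (Trans.pop t) ws)
                (Trans.lab t)
                (Trans.tgt t , zipWith _++_ (Trans.push t) ws)

data Run {k nΣ : ℕ} (M : MPA k nΣ) : Config M → List (Fin nΣ) → Config M → Set where
  done : ∀ {c} → Run M c [] c
  next : ∀ {c a c' τ c''} → Step M c a c' → Run M c' τ c'' → Run M c (pre a ++ τ) c''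

initConfig : {k nΣ : ℕ} (M : MPA k nΣ) → Config M
initConfig {k} M = q₀ M , ((γ₀ M ∷ bot M ∷ []) ∷v replicate k (bot M ∷ []))

Lang : {k nΣ : ℕ} (M : MPA k nΣ) → List (Fin nΣ) → Set
Lang {k} M τ = Σ (Fin (nQ M)) λ q → (q ∈ F M)
  × Run M (initConfig M) τ (q , replicate (suc k) (bot M ∷ []))

IsOMPA : {k nΣ : ℕ} → MPA k nΣ → Set
IsOMPA {k} M = ∀ {t} → t ∈ Δ M → Σ (Fin (suc k)) λ i → ∀ j →
  (toℕ j < toℕ i → lookup (Trans.pop t) j ≡ just (bot M))
  × (toℕ i < toℕ j → lookup (Trans.pop t) j ≡ nothing)

-- Normal form, case (a) (indices are 0-based: stack 1 is index 0).
NFa : {k nΣ : ℕ} (M : MPA k nΣ) → Trans (suc k) (nQ M) nΣ (nΓ M) → Set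
NFa {k} M t =
  (Σ (Fin (nΓ M)) λ γ → lookup (Trans.pop t) Fin.zero ≡ just γ)
  × (∀ j → 1 ≤ toℕ j →
       (lookup (Trans.pop t) j ≡ nothing)
       × (length (lookup (Trans.push t) j) ≤ 1)
       × All (λ x → x ≢ bot M) (lookup (Trans.push t) j))
  where import Data.Fin as Fin

NFb : {k nΣ : ℕ} (M : MPA k nΣ) → Trans (suc k) (nQ M) nΣ (nΓ M) → Set
NFb {k} M t = Σ (Fin (suc k)) λ i → (1 ≤ toℕ i)
  × (Σ (Fin (nΓ M)) λ γ → (γ ≢ bot M) × (lookup (Trans.pop t) i ≡ just γ))
  × (∀ j → toℕ j < toℕ i → lookup (Trans.pop t) j ≡ just (bot M))
  × (∀ j → toℕ i < toℕ j → lookup (Trans.pop t) j ≡ nothing)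
  × (Σ (Fin (nΓ M)) λ γ' → (γ' ≢ bot M)
       × (lookup (Trans.push t) Fin.zero ≡ γ' ∷ bot M ∷ []))
  × (∀ j → 1 ≤ toℕ j → toℕ j < toℕ i → lookup (Trans.push t) j ≡ bot M ∷ [])
  × (∀ j → toℕ i ≤ toℕ j → lookup (Trans.push t) j ≡ [])
  where import Data.Fin as Fin

NormalForm : {k nΣ : ℕ} → MPA k nΣ → Set
NormalForm M = ∀ {t} → t ∈ Δ M → NFa M t ⊎ NFb M t

-- Generalized pushdown automata (state set P, input Σ', stack Γ).
-- δ(p,γ,a,p') ⊆ Γ* is an arbitrary set of words (a predicate).

record GPA (P Σ' Γ : Set) : Set₁ where
  field
    δ  : P → Γ → Maybe Σ' → P → List Γ → Set
    p₀ : P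
    γ₀ : Γ
    F  : List P

data GStep {P Σ' Γ : Set} (G : GPA P Σ' Γ) : P × List Γ → Maybe Σ' → P × List Γ → Set where
  gstep : ∀ {p γ w a p' u} → GPA.δ G p γ a p' u → GStep G (p , γ ∷ w) a (p' , u ++ w)

data GRun {P Σ' Γ : Set} (G : GPA P Σ' Γ) : P × List Γ → List Σ' → P × List Γ → Set where
  gdone : ∀ {c} → GRun G c [] c
  gnext : ∀ {c a c' τ c''} → GStep G c a c' → GRun G c' τ c'' → GRun G c (pre a ++ τ) c''

GLang : {P Σ' Γ : Set} → GPA P Σ' Γ → List Σ' → Set
GLang {P} G τ = Σ P λ p → (p ∈ GPA.F G) × GRun G (GPA.p₀ G , GPA.γ₀ G ∷ []) τ (p , [])

data PState (Q : Set) : Set where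
  st   : Q → PState Q
  pinit : PState Q
  pfin  : PState Q

-- Between two pops of its last stack, an OMPA in normal form only pushes onto that stack, at most one
-- letter per move, and when it pops the last stack its stacks 1 … n-1 are empty (normal form (b)).
-- A run of M therefore splits into phases, each a run of an automaton on stacks 1 … n-1 that reads the
-- letters pushed onto the last stack as its input and starts afresh from the configuration created by
-- the pop opening the phase. The GPA keeps M's last stack as its own stack and performs a whole phase in
-- one move: from p₁ with top γ it may go to p₂ pushing the reverse of any word accepted by the phase
-- automaton M⟨p₁,γ,p₂⟩; a final move to p_f checks that M accepts with all its stacks empty. A phase
-- automaton has 2 + |Q| states and at most 2|Δ| + 2 transitions, so its size is linear in |M|.

module Submission where

open import Defs hiding (trans)
open Trans
open import Data.Nat using (ℕ; zero; suc; _+_; _*_; _≤_; _<_; _∸_; z≤n; s≤s)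
import Data.Nat.Properties as ℕₚ
open import Data.Nat.Tactic.RingSolver using (solve-∀)
open import Data.Fin using (Fin; toℕ; inject₁; fromℕ) renaming (zero to fzero; suc to fsuc)
import Data.Fin as Fin
import Data.Fin.Properties as Finₚ
open import Data.Empty using (⊥; ⊥-elim)
open import Data.Maybe using (Maybe; just; nothing; fromMaybe)
import Data.Maybe.Properties as Maybeₚ
open import Data.Product using (Σ; ∃; _×_; _,_; proj₁; proj₂)
open import Data.Sum using (_⊎_; inj₁; inj₂)
open import Data.List using (List; []; _∷_; _++_; length; reverse; map; head; filter; deduplicate)
import Data.List.Properties as List
open import Data.List.Relation.Unary.All using (All; []; _∷_)
import Data.List.Relation.Unary.All as All
import Data.List.Relation.Unary.All.Properties as Allₚ
open import Data.List.Relation.Unary.Any using (here; there)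
import Data.List.Relation.Unary.Unique.DecPropositional.Properties as Uniqueₚ
open import Data.List.Membership.Propositional using (_∈_)
open import Data.List.Membership.Propositional.Properties
  using (∈-filter⁻; ∈-filter⁺; ∈-map⁻; ∈-map⁺; ∈-++⁻; ∈-++⁺ˡ; ∈-++⁺ʳ; ∈-deduplicate⁻; ∈-deduplicate⁺)
open import Data.Vec using (Vec; []; _∷_; lookup; zipWith; replicate; init; last; _∷ʳ_; initLast)
open import Data.Vec.Properties using (init-∷ʳ; last-∷ʳ)
import Data.Vec.Properties as Vecₚ
open import Function.Bundles using (_⇔_; mk⇔)
open import Relation.Nullary using (Dec; yes; no; ¬?; _×-dec_)
open import Relation.Unary using (Decidable)
open import Relation.Binary.Definitions using (DecidableEquality; tri<; tri≈; tri>)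
open import Relation.Binary.PropositionalEquality

module _ {A : Set} where

  init-∷ʳ-last : ∀ {m} (v : Vec A (suc m)) → init v ∷ʳ last v ≡ v
  init-∷ʳ-last v = sym (proj₂ (proj₂ (initLast v)))

  lookup-∷ʳ-inject₁ : ∀ {m} (v : Vec A m) a i → lookup (v ∷ʳ a) (inject₁ i) ≡ lookup v i
  lookup-∷ʳ-inject₁ (x ∷ v) a fzero    = refl
  lookup-∷ʳ-inject₁ (x ∷ v) a (fsuc i) = lookup-∷ʳ-inject₁ v a i

  lookup-∷ʳ-fromℕ : ∀ {m} (v : Vec A m) a → lookup (v ∷ʳ a) (fromℕ m) ≡ a
  lookup-∷ʳ-fromℕ []      a = refl
  lookup-∷ʳ-fromℕ (x ∷ v) a = lookup-∷ʳ-fromℕ v a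

  lookup-init : ∀ {m} (v : Vec A (suc m)) i → lookup (init v) i ≡ lookup v (inject₁ i)
  lookup-init v i = begin
    lookup (init v) i                    ≡⟨ lookup-∷ʳ-inject₁ (init v) (last v) i ⟨
    lookup (init v ∷ʳ last v) (inject₁ i) ≡⟨ cong (λ u → lookup u (inject₁ i)) (init-∷ʳ-last v) ⟩
    lookup v (inject₁ i)                 ∎
    where open ≡-Reasoning

  lookup-last : ∀ {m} (v : Vec A (suc m)) → lookup v (fromℕ m) ≡ last v
  lookup-last {m} v = begin
    lookup v (fromℕ m)                  ≡⟨ cong (λ u → lookup u (fromℕ m)) (init-∷ʳ-last v) ⟨
    lookup (init v ∷ʳ last v) (fromℕ m) ≡⟨ lookup-∷ʳ-fromℕ (init v) (last v) ⟩
    last v                              ∎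
    where open ≡-Reasoning

  replicate-∷ʳ : ∀ m (x : A) → replicate m x ∷ʳ x ≡ replicate (suc m) x
  replicate-∷ʳ zero    x = refl
  replicate-∷ʳ (suc m) x = cong (x ∷_) (replicate-∷ʳ m x)

  init-replicate : ∀ m (x : A) → init (replicate (suc m) x) ≡ replicate m x
  init-replicate m x = trans (cong init (sym (replicate-∷ʳ m x))) (init-∷ʳ x (replicate m x))

  last-replicate : ∀ m (x : A) → last (replicate (suc m) x) ≡ x
  last-replicate m x = trans (cong last (sym (replicate-∷ʳ m x))) (last-∷ʳ x (replicate m x))

  lookup-ext : ∀ {m} (u v : Vec A m) → (∀ i → lookup u i ≡ lookup v i) → u ≡ v
  lookup-ext []      []      eq = refl
  lookup-ext (x ∷ u) (y ∷ v) eq = cong₂ _∷_ (eq fzero) (lookup-ext u v (λ i → eq (fsuc i)))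

module _ {A B C : Set} (f : A → B → C) where

  zipWith-∷ʳ : ∀ {m} (u : Vec A m) v a b → zipWith f (u ∷ʳ a) (v ∷ʳ b) ≡ zipWith f u v ∷ʳ f a b
  zipWith-∷ʳ []      []      a b = refl
  zipWith-∷ʳ (x ∷ u) (y ∷ v) a b = cong (f x y ∷_) (zipWith-∷ʳ u v a b)

  zipWith-init∷ʳlast : ∀ {m} (u : Vec A (suc m)) v b →
    zipWith f u (v ∷ʳ b) ≡ zipWith f (init u) v ∷ʳ f (last u) b
  zipWith-init∷ʳlast u v b =
    trans (cong (λ x → zipWith f x (v ∷ʳ b)) (sym (init-∷ʳ-last u))) (zipWith-∷ʳ (init u) v (last u) b)

  zipWith-split : ∀ {m} (u : Vec A (suc m)) v →
    zipWith f u v ≡ zipWith f (init u) (init v) ∷ʳ f (last u) (last v)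
  zipWith-split u v =
    trans (cong (zipWith f u) (sym (init-∷ʳ-last v))) (zipWith-init∷ʳlast u (init v) (last v))

  init-zipWith : ∀ {m} (u : Vec A (suc m)) v → init (zipWith f u v) ≡ zipWith f (init u) (init v)
  init-zipWith u v = trans (cong init (zipWith-split u v)) (init-∷ʳ (f (last u) (last v)) (zipWith f (init u) (init v)))

  last-zipWith : ∀ {m} (u : Vec A (suc m)) v → last (zipWith f u v) ≡ f (last u) (last v)
  last-zipWith u v = trans (cong last (zipWith-split u v)) (last-∷ʳ (f (last u) (last v)) (zipWith f (init u) (init v)))

pointwise-∷ʳ : ∀ {A B : Set} (R : A → B → Set) {m} (u : Vec A m) (v : Vec B m) {a b} →
  (∀ i → R (lookup u i) (lookup v i)) → R a b → ∀ i → R (lookup (u ∷ʳ a) i) (lookup (v ∷ʳ b) i)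
pointwise-∷ʳ R []      []      _ r fzero    = r
pointwise-∷ʳ R (x ∷ u) (y ∷ v) h r fzero    = h fzero
pointwise-∷ʳ R (x ∷ u) (y ∷ v) h r (fsuc i) = pointwise-∷ʳ R u v (λ j → h (fsuc j)) r i

reverse-pre-++ : ∀ {A : Set} (x : Maybe A) τ w → reverse (pre x ++ τ) ++ w ≡ reverse τ ++ pre x ++ w
reverse-pre-++ nothing  τ w = refl
reverse-pre-++ (just x) τ w = trans (cong (_++ w) (List.unfold-reverse x τ)) (List.++-assoc (reverse τ) (x ∷ []) w)

reverse-++-pre : ∀ {A : Set} τ (x : Maybe A) w → reverse (τ ++ pre x) ++ w ≡ pre x ++ reverse τ ++ w
reverse-++-pre τ nothing  w = cong (λ σ → reverse σ ++ w) (List.++-identityʳ τ)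
reverse-++-pre τ (just x) w = cong (_++ w) (List.reverse-++ τ (x ∷ []))

length≤1⇒pre-head : ∀ {A : Set} (l : List A) → length l ≤ 1 → pre (head l) ≡ l
length≤1⇒pre-head []          _               = refl
length≤1⇒pre-head (x ∷ [])    _               = refl
length≤1⇒pre-head (x ∷ y ∷ l) (s≤s ())

unpop : ∀ {A : Set} → Maybe A → List A → List A
unpop g w = pre g ++ w

module _ {A : Set} where

  zipWith-unpop-idle : ∀ {m} (vs : Vec (List A) m) → zipWith unpop (replicate m nothing) vs ≡ vs
  zipWith-unpop-idle vs = trans (Vecₚ.zipWith-replicate₁ _ nothing vs) (Vecₚ.map-id vs)

  zipWith-++-idle : ∀ {m} (vs : Vec (List A) m) → zipWith _++_ (replicate m []) vs ≡ vs
  zipWith-++-idle vs = trans (Vecₚ.zipWith-replicate₁ _ [] vs) (Vecₚ.map-id vs)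

module _ {n : ℕ} {⊥ₛ : Fin n} where

  isStack-⊥ : IsStack ⊥ₛ (⊥ₛ ∷ [])
  isStack-⊥ = [] , refl , []

  isStack-⊥∷ : ∀ {w} → IsStack ⊥ₛ (⊥ₛ ∷ w) → w ≡ []
  isStack-⊥∷ ([]    , refl , _)      = refl
  isStack-⊥∷ (_ ∷ _ , refl , x≢⊥ ∷ _) = ⊥-elim (x≢⊥ refl)

  isStack-tail : ∀ {γ w} → γ ≢ ⊥ₛ → IsStack ⊥ₛ (γ ∷ w) → IsStack ⊥ₛ w
  isStack-tail γ≢⊥ ([]    , refl , _)     = ⊥-elim (γ≢⊥ refl)
  isStack-tail _   (_ ∷ u , refl , _ ∷ ok) = u , refl , ok

  isStack-++ : ∀ {u w} → All (_≢ ⊥ₛ) u → IsStack ⊥ₛ w → IsStack ⊥ₛ (u ++ w)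
  isStack-++ []                 s = s
  isStack-++ {x ∷ _} (x≢⊥ ∷ ok) s with isStack-++ ok s
  ... | v , eq , okᵥ = x ∷ v , cong (x ∷_) eq , x≢⊥ ∷ okᵥ

Trans-≟ : ∀ {n nQ nΣ nΓ} → DecidableEquality (Trans n nQ nΣ nΓ)
Trans-≟ t t′
  with src t Fin.≟ src t′ | Vecₚ.≡-dec (Maybeₚ.≡-dec Fin._≟_) (pop t) (pop t′)
     | Maybeₚ.≡-dec Fin._≟_ (lab t) (lab t′) | tgt t Fin.≟ tgt t′
     | Vecₚ.≡-dec (List.≡-dec Fin._≟_) (push t) (push t′)
... | yes refl | yes refl | yes refl | yes refl | yes refl = yes refl
... | no ne | _      | _      | _      | _      = no λ { refl → ne refl }
... | yes _ | no ne  | _      | _      | _      = no λ { refl → ne refl }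
... | yes _ | yes _  | no ne  | _      | _      = no λ { refl → ne refl }
... | yes _ | yes _  | yes _  | no ne  | _      = no λ { refl → ne refl }
... | yes _ | yes _  | yes _  | yes _  | no ne  = no λ { refl → ne refl }

normalForm⇒ompa : ∀ {k nΣ} (M : MPA k nΣ) → NormalForm M → IsOMPA M
normalForm⇒ompa M nf t∈ with nf t∈
... | inj₁ (_ , idle) = fzero , λ j → (λ ()) , λ 0<j → proj₁ (idle j 0<j)
... | inj₂ (i , _ , _ , below , above , _) = i , λ j → below j , above j

Enabled : ∀ {n m} → Fin n → Vec (Maybe (Fin n)) m → Vec (List (Fin n)) m → Set
Enabled ⊥ₛ pops ws = ∀ i → IsStack ⊥ₛ (pre (lookup pops i) ++ lookup ws i)

module _ {k nΣ : ℕ} {M : MPA k nΣ} where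

  step-at : ∀ {t c a c′} → t ∈ Δ M → (ws : Vec (List (Fin (nΓ M))) (suc k)) → Enabled (bot M) (pop t) ws →
    c ≡ (src t , zipWith unpop (pop t) ws) → a ≡ lab t →
    c′ ≡ (tgt t , zipWith _++_ (push t) ws) → Step M c a c′
  step-at t∈Δ ws enabled refl refl refl = step t∈Δ ws enabled

  run-≡ : ∀ {c₁ c₂ τ c₁′ c₂′} → c₁ ≡ c₂ → c₁′ ≡ c₂′ → Run M c₁ τ c₁′ → Run M c₂ τ c₂′
  run-≡ refl refl r = r

  run-++ : ∀ {c τ c′ τ′ c″} → Run M c τ c′ → Run M c′ τ′ c″ → Run M c (τ ++ τ′) c″
  run-++ done r = r
  run-++ (next {a = a} {τ = τ} s r) r′ =
    subst (λ x → Run M _ x _) (sym (List.++-assoc (pre a) τ _)) (next s (run-++ r r′))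

  run-∷ʳ : ∀ {c τ c′ a c″} → Run M c τ c′ → Step M c′ a c″ → Run M c (τ ++ pre a) c″
  run-∷ʳ {a = a} r s = run-++ r (subst (λ x → Run M _ x _) (List.++-identityʳ (pre a)) (next s done))

size-identity : ∀ n q σ γ d →
  suc n + (2 + q) + γ + γ + (suc d + suc d) + (n + q + 2 * σ) ≡ 2 * (suc (suc n) + q + σ + γ + d) + 1
size-identity = solve-∀

module Construction {k nΣ : ℕ} (M : MPA (suc k) nΣ) where

  Γ Q Q′ T T′ : Set
  Γ  = Fin (nΓ M)
  Q  = Fin (nQ M)
  Q′ = Fin (2 + nQ M)
  T  = Trans (suc (suc k)) (nQ M) nΣ (nΓ M)
  T′ = Trans (suc k) (2 + nQ M) (nΓ M) (nΓ M)

  ⊥ₛ : Γ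
  ⊥ₛ = bot M

  open import Data.List.Membership.DecPropositional (Fin._≟_ {nQ M}) using (_∈?_)

  start final : Q′
  start = fzero
  final = fsuc fzero

  inner : Q → Q′
  inner q = fsuc (fsuc q)

  record Opening : Set where
    constructor opening
    field
      target : Q
      top    : Γ
      label  : Maybe Γ

  open Opening

  startPop : Vec (Maybe Γ) (suc k)
  startPop = just (γ₀ M) ∷ replicate k nothing

  openTrans : Opening → T′
  openTrans o = record
    { src = start ; pop = startPop ; lab = label o
    ; tgt = inner (target o) ; push = (top o ∷ []) ∷ replicate k [] }

  acceptTrans : T′
  acceptTrans = record
    { src = start ; pop = startPop ; lab = nothing
    ; tgt = final ; push = [] ∷ replicate k [] }

  lowerTrans : T → T′
  lowerTrans t = record
    { src = inner (src t) ; pop = init (pop t) ; lab = head (last (push t))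
    ; tgt = inner (tgt t) ; push = init (push t) }

  AtMostOneLetter : List Γ → Set
  AtMostOneLetter l = pre (head l) ≡ l × All (_≢ ⊥ₛ) l

  Lowerable : T → Set
  Lowerable t = last (pop t) ≡ nothing × AtMostOneLetter (last (push t))

  lowerable? : Decidable Lowerable
  lowerable? t =
    Maybeₚ.≡-dec Fin._≟_ (last (pop t)) nothing
    ×-dec (List.≡-dec Fin._≟_ (pre (head l)) l ×-dec All.all? (λ x → ¬? (x Fin.≟ ⊥ₛ)) l)
    where l = last (push t)

  -- γ₀ is a junk value: in normal form (b) the push onto stack 1 is never empty.
  firstTop : T → Γ
  firstTop t = fromMaybe (γ₀ M) (head (lookup (push t) fzero))

  Resumes : Q → Γ → T → Set
  Resumes p γ t = src t ≡ p × last (pop t) ≡ just γ × firstTop t ≢ ⊥ₛ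

  resumes? : ∀ p γ → Decidable (Resumes p γ)
  resumes? p γ t =
    src t Fin.≟ p ×-dec (Maybeₚ.≡-dec Fin._≟_ (last (pop t)) (just γ) ×-dec ¬? (firstTop t Fin.≟ ⊥ₛ))

  resumption : T → Opening
  resumption t = opening (tgt t) (firstTop t) nothing

  -- G's stack is M's last stack including its ⊥, so the phase from p₀ emits the ⊥ initially there.
  openings : PState Q → Γ → List Opening
  openings pinit  _ = opening (q₀ M) (γ₀ M) (just ⊥ₛ) ∷ []
  openings (st p) γ = map resumption (filter (resumes? p γ) (Δ M))
  openings pfin   _ = []

  Proper : Opening → Set
  Proper o = top o ≢ ⊥ₛ

  openings-proper : ∀ p γ → All Proper (openings p γ)
  openings-proper pinit  γ = γ₀≢bot M ∷ []
  openings-proper (st p) γ = Allₚ.map⁺ (All.tabulate λ t∈ → proj₂ (proj₂ (proj₂ (∈-filter⁻ (resumes? p γ) {xs = Δ M} t∈))))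
  openings-proper pfin   γ = []

  candidates : List Opening → List T′
  candidates os = map openTrans os ++ acceptTrans ∷ map lowerTrans (filter lowerable? (Δ M))

  data Candidate (os : List Opening) : T′ → Set where
    opened    : ∀ {o} → o ∈ os → Candidate os (openTrans o)
    accepting : Candidate os acceptTrans
    lowered   : ∀ {t} → t ∈ Δ M → Lowerable t → Candidate os (lowerTrans t)

  candidate : ∀ os {t} → t ∈ deduplicate Trans-≟ (candidates os) → Candidate os t
  candidate os t∈ with ∈-++⁻ (map openTrans os) (∈-deduplicate⁻ Trans-≟ (candidates os) t∈)
  ... | inj₁ t∈os with ∈-map⁻ openTrans t∈os
  ...   | _ , o∈ , refl = opened o∈
  candidate os t∈ | inj₂ (here refl) = accepting
  candidate os t∈ | inj₂ (there t∈Δ) with ∈-map⁻ lowerTrans t∈Δ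
  ...   | t₀ , t₀∈ , refl = let t₀∈Δ , low = ∈-filter⁻ lowerable? t₀∈ in lowered t₀∈Δ low

  idle-wf : WFStack ⊥ₛ nothing []
  idle-wf = z≤n , (λ _ → []) , λ ()

  replicate-idle-wf : ∀ j → WFStack ⊥ₛ (lookup (replicate k nothing) j) (lookup (replicate k []) j)
  replicate-idle-wf j =
    subst₂ (WFStack ⊥ₛ) (sym (Vecₚ.lookup-replicate j nothing)) (sym (Vecₚ.lookup-replicate j [])) idle-wf

  candidate-wf : ∀ {os} → All Proper os → ∀ {t} → Candidate os t → WFTrans ⊥ₛ t
  candidate-wf proper (opened o∈) fzero =
    s≤s z≤n , (λ _ → All.lookup proper o∈ ∷ []) , λ eq → ⊥-elim (γ₀≢bot M (Maybeₚ.just-injective eq))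
  candidate-wf proper (opened o∈) (fsuc j) = replicate-idle-wf j
  candidate-wf proper accepting fzero =
    z≤n , (λ _ → []) , λ eq → ⊥-elim (γ₀≢bot M (Maybeₚ.just-injective eq))
  candidate-wf proper accepting (fsuc j) = replicate-idle-wf j
  candidate-wf proper (lowered {t} t∈Δ _) i =
    subst₂ (WFStack ⊥ₛ) (sym (lookup-init (pop t) i)) (sym (lookup-init (push t) i))
      (All.lookup (Δ-wf M) t∈Δ (inject₁ i))

  phaseMPA : (os : List Opening) → All Proper os → List Q′ → MPA k (nΓ M)
  phaseMPA os proper F′ = record
    { nQ = 2 + nQ M ; nΓ = nΓ M ; bot = ⊥ₛ ; γ₀ = γ₀ M ; γ₀≢bot = γ₀≢bot M ; q₀ = start ; F = F′
    ; Δ = deduplicate Trans-≟ (candidates os) ; Δ-unique = Uniqueₚ.deduplicate-! Trans-≟ (candidates os)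
    ; Δ-wf = All.tabulate λ t∈ → candidate-wf proper (candidate os t∈) }

  module _ {os : List Opening} {proper : All Proper os} {F′ : List Q′} where

    private
      M′ : MPA k (nΓ M)
      M′ = phaseMPA os proper F′

    startShape-nfa : ∀ {a q′ l} →
      NFa M′ (record { src = start ; pop = startPop ; lab = a ; tgt = q′ ; push = l ∷ replicate k [] })
    startShape-nfa = (γ₀ M , refl) , λ
      { fzero () ; (fsuc j) _ → Vecₚ.lookup-replicate j nothing , idle j }
      where
      idle : ∀ j → length (lookup (replicate k []) j) ≤ 1 × All (_≢ ⊥ₛ) (lookup (replicate k []) j)
      idle j = subst (λ l → length l ≤ 1 × All (_≢ ⊥ₛ) l) (sym (Vecₚ.lookup-replicate j [])) (z≤n , [])

    module _ {t : T} where

      private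
        popᴸ : ∀ j → lookup (pop (lowerTrans t)) j ≡ lookup (pop t) (inject₁ j)
        popᴸ = lookup-init (pop t)
        pushᴸ : ∀ j → lookup (push (lowerTrans t)) j ≡ lookup (push t) (inject₁ j)
        pushᴸ = lookup-init (push t)
        toℕᴸ : ∀ (j : Fin (suc k)) → toℕ j ≡ toℕ (inject₁ j)
        toℕᴸ j = sym (Finₚ.toℕ-inject₁ j)

      lowered-nfa : NFa M t → NFa M′ (lowerTrans t)
      lowered-nfa ((γ , pop₀) , idle) = (γ , trans (popᴸ fzero) pop₀) , idleᴸ
        where
        idleᴸ : ∀ j → 1 ≤ toℕ j → lookup (pop (lowerTrans t)) j ≡ nothing
          × length (lookup (push (lowerTrans t)) j) ≤ 1 × All (_≢ ⊥ₛ) (lookup (push (lowerTrans t)) j)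
        idleᴸ j 1≤j with idle (inject₁ j) (subst (1 ≤_) (toℕᴸ j) 1≤j)
        ... | popⱼ , len , ok rewrite sym (pushᴸ j) = trans (popᴸ j) popⱼ , len , ok

      lowered-nfb : last (pop t) ≡ nothing → NFb M t → NFb M′ (lowerTrans t)
      lowered-nfb idle (i , 1≤i , (γ , γ≢⊥ , popᵢ) , below , above , (γ′ , γ′≢⊥ , push₀) , middle , beyond) =
          i′ , subst (1 ≤_) (sym toℕi′) 1≤i
        , (γ , γ≢⊥ , trans (popᴸ i′) (trans (cong (lookup (pop t)) inject₁i′) popᵢ))
        , (λ j j<i′ → trans (popᴸ j) (below (inject₁ j) (subst₂ _<_ (toℕᴸ j) toℕi′ j<i′)))
        , (λ j i′<j → trans (popᴸ j) (above (inject₁ j) (subst₂ _<_ toℕi′ (toℕᴸ j) i′<j)))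
        , (γ′ , γ′≢⊥ , trans (pushᴸ fzero) push₀)
        , (λ j 1≤j j<i′ → trans (pushᴸ j)
              (middle (inject₁ j) (subst (1 ≤_) (toℕᴸ j) 1≤j) (subst₂ _<_ (toℕᴸ j) toℕi′ j<i′)))
        , (λ j i′≤j → trans (pushᴸ j) (beyond (inject₁ j) (subst₂ _≤_ toℕi′ (toℕᴸ j) i′≤j)))
        where
        -- Stack i is popped, so it is not the last stack, which t leaves untouched.
        not-last : suc k ≢ toℕ i
        not-last eq with trans (sym popᵢ) (trans (cong (lookup (pop t)) (Finₚ.toℕ-injective
                           (trans (sym eq) (sym (Finₚ.toℕ-fromℕ (suc k)))))) (trans (lookup-last (pop t)) idle))
        ... | ()
        i′ : Fin (suc k)
        i′ = Fin.lower₁ i not-last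
        inject₁i′ : inject₁ i′ ≡ i
        inject₁i′ = Finₚ.inject₁-lower₁ i not-last
        toℕi′ : toℕ i′ ≡ toℕ i
        toℕi′ = Finₚ.toℕ-lower₁ i not-last

    phaseMPA-nf : NormalForm M → NormalForm M′
    phaseMPA-nf nf t∈ with candidate os t∈
    ... | opened {o} _ = inj₁ (startShape-nfa {a = label o} {inner (target o)} {top o ∷ []})
    ... | accepting    = inj₁ (startShape-nfa {a = nothing} {final} {[]})
    ... | lowered {t} t∈Δ low with nf t∈Δ
    ...   | inj₁ nfa = inj₁ (lowered-nfa {t} nfa)
    ...   | inj₂ nfb = inj₂ (lowered-nfb {t} (proj₁ low) nfb)

  finalIf : ∀ {P : Set} → Dec P → List Q′
  finalIf (yes _) = final ∷ []
  finalIf (no _)  = []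

  finals : PState Q → Γ → PState Q → List Q′
  finals _      _ (st q) = inner q ∷ []
  finals _      _ pinit  = []
  finals (st p) γ pfin   = finalIf (p ∈? F M ×-dec γ Fin.≟ ⊥ₛ)
  finals pinit  _ pfin   = []
  finals pfin   _ pfin   = []

  phase : PState Q → Γ → List Q′ → MPA k (nΓ M)
  phase p₁ γ = phaseMPA (openings p₁ γ) (openings-proper p₁ γ)

  M⟨_,_,_⟩ : PState Q → Γ → PState Q → MPA k (nΓ M)
  M⟨ p₁ , γ , p₂ ⟩ = phase p₁ γ (finals p₁ γ p₂)

  δᴳ : PState Q → Γ → Maybe ⊥ → PState Q → List Γ → Set
  δᴳ p₁ γ nothing  p₂ u = Lang M⟨ p₁ , γ , p₂ ⟩ (reverse u)
  δᴳ p₁ γ (just ()) p₂ u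

  G : GPA (PState Q) ⊥ Γ
  G = record { δ = δᴳ ; p₀ = pinit ; γ₀ = ⊥ₛ ; F = pfin ∷ [] }

  length-openings : ∀ p γ → length (openings p γ) ≤ suc (length (Δ M))
  length-openings pinit  γ = s≤s z≤n
  length-openings (st p) γ = ℕₚ.m≤n⇒m≤1+n
    (ℕₚ.≤-trans (ℕₚ.≤-reflexive (List.length-map resumption (filter (resumes? p γ) (Δ M))))
                (List.length-filter (resumes? p γ) (Δ M)))
  length-openings pfin   γ = z≤n

  length-candidates : ∀ p γ → length (candidates (openings p γ)) ≤ suc (length (Δ M)) + suc (length (Δ M))
  length-candidates p γ = begin
    length (candidates os)
      ≡⟨ List.length-++ (map openTrans os) ⟩
    length (map openTrans os) + suc (length (map lowerTrans (filter lowerable? (Δ M))))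
      ≡⟨ cong₂ (λ x y → x + suc y) (List.length-map openTrans os) (List.length-map lowerTrans (filter lowerable? (Δ M))) ⟩
    length os + suc (length (filter lowerable? (Δ M)))
      ≤⟨ ℕₚ.+-mono-≤ (length-openings p γ) (s≤s (List.length-filter lowerable? (Δ M))) ⟩
    suc (length (Δ M)) + suc (length (Δ M)) ∎
    where
    open ℕₚ.≤-Reasoning
    os = openings p γ

  size-phase : ∀ p₁ γ p₂ → size M⟨ p₁ , γ , p₂ ⟩ ≤ 3 * (size M * size M)
  size-phase p₁ γ p₂ = begin
    size M⟨ p₁ , γ , p₂ ⟩
      ≤⟨ ℕₚ.+-monoʳ-≤ (suc k + (2 + nQ M) + nΓ M + nΓ M)
           (ℕₚ.≤-trans (List.length-deduplicate Trans-≟ (candidates (openings p₁ γ))) (length-candidates p₁ γ)) ⟩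
    suc k + (2 + nQ M) + nΓ M + nΓ M + (suc D + suc D)
      ≤⟨ ℕₚ.m≤m+n _ (k + nQ M + 2 * nΣ) ⟩
    suc k + (2 + nQ M) + nΓ M + nΓ M + (suc D + suc D) + (k + nQ M + 2 * nΣ)
      ≡⟨ size-identity k (nQ M) nΣ (nΓ M) D ⟩
    2 * s + 1
      ≤⟨ ℕₚ.+-monoʳ-≤ (2 * s) (s≤s z≤n) ⟩
    2 * s + s
      ≡⟨ ℕₚ.+-comm (2 * s) s ⟩
    3 * s
      ≤⟨ ℕₚ.*-monoʳ-≤ 3 (ℕₚ.m≤m*n s s) ⟩
    3 * (s * s) ∎
    where
    open ℕₚ.≤-Reasoning
    s = size M
    D = length (Δ M)

  Stack : Set
  Stack = List Γ

  bots : ∀ m → Vec Stack m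
  bots m = replicate m (⊥ₛ ∷ [])

  openStacks : Γ → Vec Stack (suc k)
  openStacks γ = (γ ∷ ⊥ₛ ∷ []) ∷ bots k

  openStacks-++-idle : ∀ γ → zipWith _++_ (openStacks γ) (replicate (suc k) []) ≡ openStacks γ
  openStacks-++-idle γ = cong ((γ ∷ ⊥ₛ ∷ []) ∷_) (Vecₚ.zipWith-replicate _++_ (⊥ₛ ∷ []) [])

  change-finals : ∀ {os proper F₁ F₂ c τ c′} → Run (phaseMPA os proper F₁) c τ c′ → Run (phaseMPA os proper F₂) c τ c′
  change-finals done                          = done
  change-finals (next (step t∈ ws enabled) r) = next (step t∈ ws enabled) (change-finals r)

  lowered-step : ∀ {t} → t ∈ Δ M → last (pop t) ≡ nothing → ∀ {vs w} → Enabled ⊥ₛ (init (pop t)) vs → IsStack ⊥ₛ w →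
    Step M (src t , zipWith unpop (init (pop t)) vs ∷ʳ w) (lab t)
           (tgt t , zipWith _++_ (init (push t)) vs ∷ʳ (last (push t) ++ w))
  lowered-step {t} t∈ idle {vs} {w} enabled w-ok = step-at t∈ (vs ∷ʳ w) enabled′
      (cong (src t ,_) (sym (trans (zipWith-init∷ʳlast unpop (pop t) vs w)
        (cong (λ g → zipWith unpop (init (pop t)) vs ∷ʳ unpop g w) idle))))
      refl
      (cong (tgt t ,_) (sym (zipWith-init∷ʳlast _++_ (push t) vs w)))
    where
    enabled′ : Enabled ⊥ₛ (pop t) (vs ∷ʳ w)
    enabled′ = subst (λ p → Enabled ⊥ₛ p (vs ∷ʳ w)) (init-∷ʳ-last (pop t))
      (pointwise-∷ʳ (λ g x → IsStack ⊥ₛ (pre g ++ x)) (init (pop t)) vs enabled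
        (subst (λ g → IsStack ⊥ₛ (pre g ++ w)) (sym idle) w-ok))

  module _ {os : List Opening} {proper : All Proper os} {F′ : List Q′} where

    private
      M′ : MPA k (nΓ M)
      M′ = phaseMPA os proper F′

    start-enabled : Enabled ⊥ₛ startPop (bots (suc k))
    start-enabled fzero    = γ₀ M ∷ [] , refl , γ₀≢bot M ∷ []
    start-enabled (fsuc j) =
      subst₂ (λ g x → IsStack ⊥ₛ (pre g ++ x)) (sym (Vecₚ.lookup-replicate j nothing))
        (sym (Vecₚ.lookup-replicate j (⊥ₛ ∷ []))) isStack-⊥

    startShape-step : ∀ {a q′ l} →
      record { src = start ; pop = startPop ; lab = a ; tgt = q′ ; push = l ∷ replicate k [] } ∈ Δ M′ →
      Step M′ (start , openStacks (γ₀ M)) a (q′ , (l ++ ⊥ₛ ∷ []) ∷ bots k)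
    startShape-step {l = l} t∈ = step-at t∈ (bots (suc k)) start-enabled
      (cong (λ vs → start , (γ₀ M ∷ ⊥ₛ ∷ []) ∷ vs) (sym (zipWith-unpop-idle (bots k))))
      refl
      (cong (λ vs → _ , (l ++ ⊥ₛ ∷ []) ∷ vs) (sym (zipWith-++-idle (bots k))))

    opening-step : ∀ {o} → o ∈ os → Step M′ (start , openStacks (γ₀ M)) (label o) (inner (target o) , openStacks (top o))
    opening-step o∈ = startShape-step (∈-deduplicate⁺ Trans-≟ (∈-++⁺ˡ (∈-map⁺ openTrans o∈)))

    accept-step : Step M′ (start , openStacks (γ₀ M)) nothing (final , bots (suc k))
    accept-step = startShape-step (∈-deduplicate⁺ Trans-≟ (∈-++⁺ʳ (map openTrans os) (here refl)))

    record Lift (q : Q) (vs : Vec Stack (suc k)) (τ : List Γ) (c′ : Config M′) (w : Stack) : Set where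
      constructor lift
      field
        q₂       : Q
        at-inner : proj₁ c′ ≡ inner q₂
        stack-ok : IsStack ⊥ₛ (reverse τ ++ w)
        input    : List (Fin nΣ)
        run      : Run M (q , vs ∷ʳ w) input (q₂ , proj₂ c′ ∷ʳ (reverse τ ++ w))

    -- Only lowered transitions leave inner states; each is replayed by M, its emitted letter pushed on the last stack.
    lift-run : ∀ {c τ c′} → Run M′ c τ c′ → ∀ {q} → proj₁ c ≡ inner q → ∀ {w} → IsStack ⊥ₛ w → Lift q (proj₂ c) τ c′ w
    lift-run done eq w-ok = lift _ eq w-ok [] done
    lift-run (next (step t∈ vs enabled) r) eq w-ok with candidate os t∈
    lift-run (next (step t∈ vs enabled) r) () w-ok | opened _
    lift-run (next (step t∈ vs enabled) r) () w-ok | accepting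
    lift-run (next {τ = τ} (step t∈ vs enabled) r) refl {w} w-ok | lowered {t} t∈Δ (idle , pre-head , letters)
      with lift-run r refl (isStack-++ letters w-ok)
    ... | lift q₂ at-inner stack-ok input run =
      lift q₂ at-inner (subst (IsStack ⊥ₛ) (sym emitted) stack-ok) (pre (lab t) ++ input)
        (next (lowered-step t∈Δ idle enabled w-ok) (run-≡ refl (cong (λ x → q₂ , _ ∷ʳ x) (sym emitted)) run))
      where
      emitted : reverse (pre (head (last (push t))) ++ τ) ++ w ≡ reverse τ ++ (last (push t) ++ w)
      emitted = trans (reverse-pre-++ (head (last (push t))) τ w) (cong (λ x → reverse τ ++ x ++ w) pre-head)

    final-absorbing : ∀ {c τ c′} → Run M′ c τ c′ → proj₁ c ≡ final → proj₁ c′ ≡ final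
    final-absorbing done eq = eq
    final-absorbing (next (step t∈ _ _) _) eq with candidate os t∈
    final-absorbing (next (step t∈ _ _) _) () | opened _
    final-absorbing (next (step t∈ _ _) _) () | accepting
    final-absorbing (next (step t∈ _ _) _) () | lowered _ _

    record Opened (τ : List Γ) (c′ : Config M′) : Set where
      constructor opened-by
      field
        o       : Opening
        o∈      : o ∈ os
        rest    : List Γ
        input-≡ : τ ≡ pre (label o) ++ rest
        run     : Run M′ (inner (target o) , openStacks (top o)) rest c′

    opens : ∀ {c τ c′} → Run M′ c τ c′ → c ≡ (start , openStacks (γ₀ M)) → ∀ {q} → proj₁ c′ ≡ inner q → Opened τ c′
    opens done refl ()
    opens (next (step t∈ _ _) r) eq at with candidate os t∈
    opens (next (step t∈ (v ∷ vs) _) r) eq at | opened {o} o∈ =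
      opened-by o o∈ _ refl (run-≡ (cong (inner (target o) ,_) stacks) refl r)
      where
      tops : γ₀ M ∷ v ≡ γ₀ M ∷ ⊥ₛ ∷ [] × zipWith unpop (replicate k nothing) vs ≡ bots k
      tops = Vecₚ.∷-injective (cong proj₂ eq)
      stacks : (top o ∷ v) ∷ zipWith _++_ (replicate k []) vs ≡ openStacks (top o)
      stacks = cong₂ (λ x y → (top o ∷ x) ∷ y) (List.∷-injectiveʳ (proj₁ tops))
                 (trans (zipWith-++-idle vs) (trans (sym (zipWith-unpop-idle vs)) (proj₂ tops)))
    opens (next (step t∈ _ _) r) _ at | accepting with trans (sym (final-absorbing r refl)) at
    ... | ()
    opens (next (step t∈ _ _) r) () at | lowered _ _

  finalIf-sound : ∀ {P : Set} (d : Dec P) {q} → q ∈ finalIf d → P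
  finalIf-sound (yes p) _ = p
  finalIf-sound (no _)  ()

  finalIf-complete : ∀ {P : Set} (d : Dec P) → P → final ∈ finalIf d
  finalIf-complete (yes _) _ = here refl
  finalIf-complete (no ¬p) p = ⊥-elim (¬p p)

  record PhaseLift (p₁ : PState Q) (γ : Γ) (q₂ : Q) (u w₀ : Stack) : Set where
    constructor phase-lift
    field
      o        : Opening
      o∈       : o ∈ openings p₁ γ
      stack-ok : IsStack ⊥ₛ (u ++ w₀)
      input    : List (Fin nΣ)
      run      : Run M (target o , openStacks (top o) ∷ʳ (pre (label o) ++ w₀)) input (q₂ , bots (suc k) ∷ʳ (u ++ w₀))

  lift-phase : ∀ {p₁ γ q₂ u w₀} → δᴳ p₁ γ nothing (st q₂) u →
    (∀ {o} → o ∈ openings p₁ γ → IsStack ⊥ₛ (pre (label o) ++ w₀)) → PhaseLift p₁ γ q₂ u w₀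
  lift-phase {u = u} {w₀} (_ , here refl , r) w₀-ok with opens r refl refl
  ... | opened-by o o∈ rest input-≡ r′ with lift-run r′ refl (w₀-ok o∈)
  ... | lift _ refl stack-ok input run =
    phase-lift o o∈ (subst (IsStack ⊥ₛ) last-stack stack-ok) input
      (run-≡ refl (cong (λ x → _ , bots (suc k) ∷ʳ x) last-stack) run)
    where
    last-stack : reverse rest ++ pre (label o) ++ w₀ ≡ u ++ w₀
    last-stack = begin
      reverse rest ++ pre (label o) ++ w₀ ≡⟨ reverse-pre-++ (label o) rest w₀ ⟨
      reverse (pre (label o) ++ rest) ++ w₀ ≡⟨ cong (λ x → reverse x ++ w₀) input-≡ ⟨
      reverse (reverse u) ++ w₀            ≡⟨ cong (_++ w₀) (List.reverse-involutive u) ⟩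
      u ++ w₀                             ∎
      where open ≡-Reasoning

  record Resumed (q : Q) (γ : Γ) (o : Opening) : Set where
    constructor resumed
    field
      {t}     : T
      t∈      : t ∈ Δ M
      resumes : Resumes q γ t
      o≡      : o ≡ resumption t

  resumed-of : ∀ {q γ o} → o ∈ openings (st q) γ → Resumed q γ o
  resumed-of {q} {γ} o∈ with ∈-map⁻ resumption o∈
  ... | t , t∈ , refl = let t∈Δ , resumes = ∈-filter⁻ (resumes? q γ) {xs = Δ M} t∈ in resumed t∈Δ resumes refl

  module _ (nf : NormalForm M) where

    record Resuming (t : T) (γ : Γ) : Set where
      field
        popped≢⊥  : γ ≢ ⊥ₛ
        init-pop  : init (pop t) ≡ replicate (suc k) (just ⊥ₛ)
        init-push : init (push t) ≡ openStacks (firstTop t)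
        last-push : last (push t) ≡ []
        top≢⊥     : firstTop t ≢ ⊥ₛ

    private
      ℓ : Fin (suc (suc k))
      ℓ = fromℕ (suc k)

      inject₁<ℓ : ∀ j → toℕ (inject₁ j) < toℕ ℓ
      inject₁<ℓ j = subst (toℕ (inject₁ j) <_) (sym (Finₚ.toℕ-fromℕ (suc k))) (Finₚ.inject₁ℕ< j)

      1≤ℓ : 1 ≤ toℕ ℓ
      1≤ℓ = subst (1 ≤_) (sym (Finₚ.toℕ-fromℕ (suc k))) (s≤s z≤n)

    nfb-index-last : ∀ {t γ} → last (pop t) ≡ just γ → (nfb : NFb M t) → proj₁ nfb ≡ ℓ
    nfb-index-last {t} popped (i , _ , _ , _ , above , _) with Finₚ.<-cmp i ℓ
    ... | tri≈ _ i≡ℓ _ = i≡ℓ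
    ... | tri> _ _ ℓ<i = ⊥-elim (ℕₚ.<⇒≱ ℓ<i (Finₚ.≤fromℕ i))
    ... | tri< i<ℓ _ _ with trans (sym popped) (trans (sym (lookup-last (pop t))) (above ℓ i<ℓ))
    ...   | ()

    resuming-nfb : ∀ {t γ} → last (pop t) ≡ just γ → (nfb : NFb M t) → proj₁ nfb ≡ ℓ → Resuming t γ
    resuming-nfb {t} {γ} popped (_ , _ , (γ′ , γ′≢⊥ , popᵢ) , below , _ , (γ″ , γ″≢⊥ , push₀) , middle , beyond) refl =
      record
        { popped≢⊥  = λ γ≡⊥ → γ′≢⊥ (trans γ′≡γ γ≡⊥)
        ; init-pop  = lookup-ext _ _ λ j →
            trans (lookup-init (pop t) j) (trans (below (inject₁ j) (inject₁<ℓ j)) (sym (Vecₚ.lookup-replicate j (just ⊥ₛ))))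
        ; init-push = lookup-ext _ _ pushes
        ; last-push = trans (sym (lookup-last (push t))) (beyond ℓ ℕₚ.≤-refl)
        ; top≢⊥     = subst (_≢ ⊥ₛ) (sym top≡γ″) γ″≢⊥
        }
      where
      γ′≡γ : γ′ ≡ γ
      γ′≡γ = Maybeₚ.just-injective (trans (sym popᵢ) (trans (lookup-last (pop t)) popped))
      top≡γ″ : firstTop t ≡ γ″
      top≡γ″ = cong (λ l → fromMaybe (γ₀ M) (head l)) push₀
      pushes : ∀ j → lookup (init (push t)) j ≡ lookup (openStacks (firstTop t)) j
      pushes fzero    = trans (lookup-init (push t) fzero) (trans push₀ (cong (λ x → x ∷ ⊥ₛ ∷ []) (sym top≡γ″)))
      pushes (fsuc j) = trans (lookup-init (push t) (fsuc j))
        (trans (middle (inject₁ (fsuc j)) (s≤s z≤n) (inject₁<ℓ (fsuc j))) (sym (Vecₚ.lookup-replicate j (⊥ₛ ∷ []))))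

    resuming : ∀ {t γ} → t ∈ Δ M → last (pop t) ≡ just γ → Resuming t γ
    resuming {t} t∈ popped with nf t∈
    ... | inj₂ nfb = resuming-nfb {t} popped nfb (nfb-index-last {t} popped nfb)
    ... | inj₁ (_ , idle) with trans (sym popped) (trans (sym (lookup-last (pop t)))
                                 (proj₁ (idle ℓ 1≤ℓ)))
    ...   | ()

    module _ {t γ} (t∈ : t ∈ Δ M) (popped : last (pop t) ≡ just γ) where

      open Resuming (resuming t∈ popped)

      pop-shape : replicate (suc k) (just ⊥ₛ) ∷ʳ just γ ≡ pop t
      pop-shape = trans (cong₂ _∷ʳ_ (sym init-pop) (sym popped)) (init-∷ʳ-last (pop t))

      push-shape : openStacks (firstTop t) ∷ʳ [] ≡ push t
      push-shape = trans (cong₂ _∷ʳ_ (sym init-push) (sym last-push)) (init-∷ʳ-last (push t))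

      resume-step : ∀ {w} → IsStack ⊥ₛ (γ ∷ w) →
        Step M (src t , bots (suc k) ∷ʳ (γ ∷ w)) (lab t) (tgt t , openStacks (firstTop t) ∷ʳ w)
      resume-step {w} ok = step-at t∈ (replicate (suc k) [] ∷ʳ w) enabled
          (cong (src t ,_) (begin
            bots (suc k) ∷ʳ (γ ∷ w)
              ≡⟨ cong (_∷ʳ (γ ∷ w)) (Vecₚ.zipWith-replicate _ (just ⊥ₛ) []) ⟨
            zipWith f (replicate (suc k) (just ⊥ₛ)) (replicate (suc k) []) ∷ʳ (γ ∷ w)
              ≡⟨ zipWith-∷ʳ f (replicate (suc k) (just ⊥ₛ)) (replicate (suc k) []) (just γ) w ⟨
            zipWith f (replicate (suc k) (just ⊥ₛ) ∷ʳ just γ) (replicate (suc k) [] ∷ʳ w)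
              ≡⟨ cong (λ p → zipWith f p (replicate (suc k) [] ∷ʳ w)) pop-shape ⟩
            zipWith f (pop t) (replicate (suc k) [] ∷ʳ w) ∎))
          refl
          (cong (tgt t ,_) (begin
            openStacks (firstTop t) ∷ʳ w
              ≡⟨ cong (_∷ʳ w) (openStacks-++-idle (firstTop t)) ⟨
            zipWith _++_ (openStacks (firstTop t)) (replicate (suc k) []) ∷ʳ ([] ++ w)
              ≡⟨ zipWith-∷ʳ _++_ (openStacks (firstTop t)) (replicate (suc k) []) [] w ⟨
            zipWith _++_ (openStacks (firstTop t) ∷ʳ []) (replicate (suc k) [] ∷ʳ w)
              ≡⟨ cong (λ p → zipWith _++_ p (replicate (suc k) [] ∷ʳ w)) push-shape ⟩
            zipWith _++_ (push t) (replicate (suc k) [] ∷ʳ w) ∎))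
        where
        open ≡-Reasoning
        f : Maybe Γ → Stack → Stack
        f g w = pre g ++ w
        enabled : Enabled ⊥ₛ (pop t) (replicate (suc k) [] ∷ʳ w)
        enabled = subst (λ p → Enabled ⊥ₛ p (replicate (suc k) [] ∷ʳ w)) pop-shape
          (pointwise-∷ʳ (λ g x → IsStack ⊥ₛ (pre g ++ x)) (replicate (suc k) (just ⊥ₛ)) (replicate (suc k) [])
            (λ j → subst₂ (λ g x → IsStack ⊥ₛ (pre g ++ x)) (sym (Vecₚ.lookup-replicate j (just ⊥ₛ)))
                     (sym (Vecₚ.lookup-replicate j [])) isStack-⊥)
            ok)

      -- Popping ⊥ from stacks 1 … n-1 forces them to be empty.
      resumed-stacks : ∀ {ws} → Enabled ⊥ₛ (pop t) ws → init ws ≡ replicate (suc k) []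
      resumed-stacks {ws} enabled = lookup-ext _ _ λ j → trans (lookup-init ws j) (trans
        (isStack-⊥∷ (subst (λ g → IsStack ⊥ₛ (pre g ++ lookup ws (inject₁ j)))
          (trans (sym (lookup-init (pop t) j)) (trans (cong (λ p → lookup p j) init-pop) (Vecₚ.lookup-replicate j (just ⊥ₛ))))
          (enabled (inject₁ j))))
        (sym (Vecₚ.lookup-replicate j [])))

    resumption-below : ∀ {q γ w o} → IsStack ⊥ₛ (γ ∷ w) → o ∈ openings (st q) γ → IsStack ⊥ₛ (pre (label o) ++ w)
    resumption-below ok o∈ with resumed-of o∈
    ... | resumed t∈ (_ , popped , _) refl = isStack-tail (Resuming.popped≢⊥ (resuming t∈ popped)) ok

    resume-sound : ∀ {q γ q₂ u w} → δᴳ (st q) γ nothing (st q₂) u → IsStack ⊥ₛ (γ ∷ w) →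
      IsStack ⊥ₛ (u ++ w) × ∃ λ τ → Run M (q , bots (suc k) ∷ʳ (γ ∷ w)) τ (q₂ , bots (suc k) ∷ʳ (u ++ w))
    resume-sound d ok with lift-phase d (resumption-below ok)
    ... | phase-lift o o∈ stack-ok input run with resumed-of o∈
    ...   | resumed {t} t∈ (refl , popped , _) refl = stack-ok , pre (lab t) ++ input , next (resume-step t∈ popped ok) run

    initial-sound : ∀ {q₂ u} → δᴳ pinit ⊥ₛ nothing (st q₂) u →
      IsStack ⊥ₛ (u ++ []) × ∃ λ τ → Run M (initConfig M) τ (q₂ , bots (suc k) ∷ʳ (u ++ []))
    initial-sound d with lift-phase {pinit} {⊥ₛ} {w₀ = []} d (λ { (here refl) → isStack-⊥ })
    ... | phase-lift _ (here refl) stack-ok input run =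
      stack-ok , input , run-≡ (cong (λ v → q₀ M , (γ₀ M ∷ ⊥ₛ ∷ []) ∷ v) (replicate-∷ʳ k (⊥ₛ ∷ []))) refl run

    AcceptsFrom : Config M → Set
    AcceptsFrom c = ∃ λ τ → Σ Q λ f → f ∈ F M × Run M c τ (f , bots (suc (suc k)))

    accepts-from : ∀ {c τ c′} → GRun G c τ c′ → ∀ {q z} → c ≡ (st q , z) → c′ ≡ (pfin , []) → IsStack ⊥ₛ z →
      AcceptsFrom (q , bots (suc k) ∷ʳ z)
    accepts-from gdone refl ()
    accepts-from (gnext (gstep {a = just ()} _) _) _ _ _
    accepts-from (gnext (gstep {a = nothing} {p' = pinit} (_ , () , _)) _) refl _ _
    accepts-from (gnext (gstep {γ = γ} {a = nothing} {p' = pfin} (_ , f∈ , _)) _) {q} refl _ ok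
      with finalIf-sound (q ∈? F M ×-dec γ Fin.≟ ⊥ₛ) f∈
    ... | q∈F , refl = [] , q , q∈F , run-≡ (cong (λ x → q , x) emptied) refl done
      where
      emptied : bots (suc (suc k)) ≡ bots (suc k) ∷ʳ _
      emptied = trans (sym (replicate-∷ʳ (suc k) (⊥ₛ ∷ []))) (cong (λ x → bots (suc k) ∷ʳ (⊥ₛ ∷ x)) (sym (isStack-⊥∷ ok)))
    accepts-from (gnext (gstep {a = nothing} {p' = st q₂} d) r) refl end ok with resume-sound d ok
    ... | ok′ , τ , run with accepts-from r refl end ok′
    ...   | τ′ , f , f∈ , run′ = τ ++ τ′ , f , f∈ , run-++ run run′

    accepted : ∀ {c τ c′} → GRun G c τ c′ → c ≡ (pinit , ⊥ₛ ∷ []) → c′ ≡ (pfin , []) → ∃ (Lang M)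
    accepted gdone refl ()
    accepted (gnext (gstep {a = just ()} _) _) _ _
    accepted (gnext (gstep {a = nothing} {p' = pinit} (_ , () , _)) _) refl _
    accepted (gnext (gstep {a = nothing} {p' = pfin} (_ , () , _)) _) refl _
    accepted (gnext (gstep {a = nothing} {p' = st q₂} d) r) refl end with initial-sound d
    ... | ok , τ , run with accepts-from r refl end ok
    ...   | τ′ , f , f∈ , run′ = τ ++ τ′ , f , f∈ , run-++ run run′

    sound : ∃ (GLang G) → ∃ (Lang M)
    sound (_ , _ , here refl , r) = accepted r refl refl

    idle-lowerable : ∀ {t} → t ∈ Δ M → last (pop t) ≡ nothing → Lowerable t
    idle-lowerable {t} t∈ idle with nf t∈
    ... | inj₁ (_ , idleⱼ) with idleⱼ ℓ 1≤ℓ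
    ...   | _ , len , letters = idle , subst AtMostOneLetter (lookup-last (push t)) (length≤1⇒pre-head _ len , letters)
    idle-lowerable {t} t∈ idle | inj₂ (i , _ , _ , _ , _ , _ , _ , beyond) =
      idle , subst AtMostOneLetter (trans (sym (beyond ℓ (Finₚ.≤fromℕ i))) (lookup-last (push t))) (refl , [])

    -- A phase opened from the configuration (p₁ , γ ∷ z₀) of G that has reached the configuration c of M.
    record Pending (p₁ : PState Q) (γ : Γ) (z₀ : Stack) (c : Config M) : Set where
      constructor pending
      field
        emitted    : List Γ
        run        : Run (phase p₁ γ []) (start , openStacks (γ₀ M)) emitted (inner (proj₁ c) , init (proj₂ c))
        last-stack : last (proj₂ c) ≡ reverse emitted ++ z₀

    close-phase : ∀ {p₁ γ q e} → Run (phase p₁ γ []) (start , openStacks (γ₀ M)) e (inner q , bots (suc k)) →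
      δᴳ p₁ γ nothing (st q) (reverse e)
    close-phase {e = e} r = inner _ , here refl , subst (λ τ → Run _ _ τ _) (sym (List.reverse-involutive e)) (change-finals r)

    accept-phase : ∀ {f} → f ∈ F M → δᴳ (st f) ⊥ₛ nothing pfin []
    accept-phase {f} f∈ = final , finalIf-complete (f ∈? F M ×-dec ⊥ₛ Fin.≟ ⊥ₛ) (f∈ , refl) , next accept-step done

    pending-lowered : ∀ {p₁ γ z₀ t ws} → t ∈ Δ M → last (pop t) ≡ nothing → Enabled ⊥ₛ (pop t) ws →
      Pending p₁ γ z₀ (src t , zipWith unpop (pop t) ws) →
      Pending p₁ γ z₀ (tgt t , zipWith _++_ (push t) ws)
    pending-lowered {p₁} {γ} {z₀} {t} {ws} t∈ idle enabled (pending e r last-stack) =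
      pending (e ++ pre (head (last (push t)))) (run-∷ʳ r lowered-move) last-stack′
      where
      low : Lowerable t
      low = idle-lowerable t∈ idle
      enabledᴸ : Enabled ⊥ₛ (init (pop t)) (init ws)
      enabledᴸ i = subst₂ (λ g x → IsStack ⊥ₛ (pre g ++ x)) (sym (lookup-init (pop t) i)) (sym (lookup-init ws i))
        (enabled (inject₁ i))
      lowered-move : Step (phase p₁ γ []) (inner (src t) , init (zipWith unpop (pop t) ws)) (head (last (push t)))
                                     (inner (tgt t) , init (zipWith _++_ (push t) ws))
      lowered-move = step-at
        (∈-deduplicate⁺ Trans-≟ (∈-++⁺ʳ (map openTrans (openings p₁ γ))
          (there (∈-map⁺ lowerTrans (∈-filter⁺ lowerable? t∈ low)))))
        (init ws) enabledᴸ (cong (inner (src t) ,_) (init-zipWith _ (pop t) ws)) refl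
        (cong (inner (tgt t) ,_) (init-zipWith _++_ (push t) ws))
      last-stack′ : last (zipWith _++_ (push t) ws) ≡ reverse (e ++ pre (head (last (push t)))) ++ z₀
      last-stack′ = begin
        last (zipWith _++_ (push t) ws)                    ≡⟨ last-zipWith _++_ (push t) ws ⟩
        last (push t) ++ last ws                           ≡⟨ cong₂ _++_ (sym (proj₁ (proj₂ low))) last-ws ⟩
        pre (head (last (push t))) ++ reverse e ++ z₀      ≡⟨ reverse-++-pre e (head (last (push t))) z₀ ⟨
        reverse (e ++ pre (head (last (push t)))) ++ z₀    ∎
        where
        open ≡-Reasoning
        last-ws : last ws ≡ reverse e ++ z₀
        last-ws = trans (sym (trans (last-zipWith _ (pop t) ws) (cong (λ g → pre g ++ last ws) idle))) last-stack

    pending-resumed : ∀ {p₁ γ z₀ t γ′ ws} → t ∈ Δ M → last (pop t) ≡ just γ′ → Enabled ⊥ₛ (pop t) ws →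
      Pending p₁ γ z₀ (src t , zipWith unpop (pop t) ws) →
      GStep G (p₁ , γ ∷ z₀) nothing (st (src t) , γ′ ∷ last ws)
      × Pending (st (src t)) γ′ (last ws) (tgt t , zipWith _++_ (push t) ws)
    pending-resumed {p₁} {γ} {z₀} {t} {γ′} {ws} t∈ popped enabled (pending e r last-stack) =
        subst (λ z → GStep G (p₁ , γ ∷ z₀) nothing (st (src t) , z)) top-stack
          (gstep (close-phase {p₁} {γ} (run-≡ refl (cong (inner (src t) ,_) init-before) r)))
      , pending [] (run-≡ refl (cong (inner (tgt t) ,_) (sym init-after)) (next (opening-step resumed∈) done))
          (trans (last-zipWith _++_ (push t) ws) (cong (_++ last ws) last-push))
      where
      open Resuming (resuming t∈ popped)
      emptied : init ws ≡ replicate (suc k) []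
      emptied = resumed-stacks t∈ popped {ws} enabled
      init-before : init (zipWith unpop (pop t) ws) ≡ bots (suc k)
      init-before = trans (init-zipWith _ (pop t) ws)
        (trans (cong₂ (zipWith unpop) init-pop emptied) (Vecₚ.zipWith-replicate _ (just ⊥ₛ) []))
      init-after : init (zipWith _++_ (push t) ws) ≡ openStacks (firstTop t)
      init-after = trans (init-zipWith _++_ (push t) ws)
        (trans (cong₂ (zipWith _++_) init-push emptied) (openStacks-++-idle (firstTop t)))
      top-stack : reverse e ++ z₀ ≡ γ′ ∷ last ws
      top-stack = trans (sym last-stack) (trans (last-zipWith _ (pop t) ws) (cong (λ g → pre g ++ last ws) popped))
      resumed∈ : resumption t ∈ openings (st (src t)) γ′
      resumed∈ = ∈-map⁺ resumption (∈-filter⁺ (resumes? (src t) γ′) t∈ (refl , popped , top≢⊥))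

    pending-accepted : ∀ {p₁ γ z₀ f} → f ∈ F M → Pending p₁ γ z₀ (f , bots (suc (suc k))) →
      GRun G (p₁ , γ ∷ z₀) [] (pfin , [])
    pending-accepted {p₁} {γ} {f = f} f∈ (pending e r last-stack) =
      gnext (gstep (close-phase {p₁} {γ} (run-≡ refl (cong (inner f ,_) (init-replicate (suc k) (⊥ₛ ∷ []))) r)))
        (subst (λ z → GRun G (st f , z) [] (pfin , [])) (trans (sym (last-replicate (suc k) (⊥ₛ ∷ []))) last-stack)
          (gnext (gstep (accept-phase f∈)) gdone))

    complete-from : ∀ {c τ c′} → Run M c τ c′ → ∀ {f} → c′ ≡ (f , bots (suc (suc k))) → f ∈ F M →
      ∀ {p₁ γ z₀} → Pending p₁ γ z₀ c → GRun G (p₁ , γ ∷ z₀) [] (pfin , [])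
    complete-from done refl f∈ p = pending-accepted f∈ p
    complete-from (next (step {t} t∈ ws enabled) r) end f∈ p with last (pop t) in popped
    ... | nothing = complete-from r end f∈ (pending-lowered t∈ popped enabled p)
    ... | just γ′ with pending-resumed t∈ popped enabled p
    ...   | g , p′ = gnext g (complete-from r end f∈ p′)

    initial-pending : Pending pinit ⊥ₛ [] (initConfig M)
    initial-pending = pending (⊥ₛ ∷ [])
      (run-≡ refl (cong (λ v → inner (q₀ M) , (γ₀ M ∷ ⊥ₛ ∷ []) ∷ v) (sym (init-replicate k (⊥ₛ ∷ []))))
        (next (opening-step (here refl)) done))
      (last-replicate k (⊥ₛ ∷ []))

    complete : ∃ (Lang M) → ∃ (GLang G)
    complete (_ , f , f∈ , r) = [] , pfin , here refl , complete-from r refl f∈ initial-pending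

  phase-normalForm : NormalForm M → ∀ p₁ γ p₂ → NormalForm M⟨ p₁ , γ , p₂ ⟩
  phase-normalForm nf p₁ γ p₂ = phaseMPA-nf {openings p₁ γ} {openings-proper p₁ γ} {finals p₁ γ p₂} nf

  phase-language : ∀ p₁ γ p₂ τ → Lang M⟨ p₁ , γ , p₂ ⟩ τ ⇔ δᴳ p₁ γ nothing p₂ (reverse τ)
  phase-language p₁ γ p₂ τ = mk⇔ (subst (Lang M⟨ p₁ , γ , p₂ ⟩) (sym (List.reverse-involutive τ)))
                                 (subst (Lang M⟨ p₁ , γ , p₂ ⟩) (List.reverse-involutive τ))

theorem4p1 : Σ ℕ λ c → ∀ {k nΣ : ℕ} (M : MPA k nΣ) → IsOMPA M → NormalForm M → 1 ≤ k →
    Σ (GPA (PState (Fin (nQ M))) ⊥ (Fin (nΓ M))) λ G →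
      (GPA.p₀ G ≡ pinit) × (GPA.γ₀ G ≡ bot M) × (GPA.F G ≡ pfin ∷ [])
      × ((∃ λ τ → Lang M τ) ⇔ (∃ λ τ → GLang G τ))
      × (∀ (p₁ : PState (Fin (nQ M))) (γ : Fin (nΓ M)) (p₂ : PState (Fin (nQ M))) →
          Σ (MPA (k ∸ 1) (nΓ M)) λ M' → IsOMPA M' × NormalForm M'
            × (∀ (τ : List (Fin (nΓ M))) → Lang M' τ ⇔ GPA.δ G p₁ γ nothing p₂ (reverse τ))
            × (size M' ≤ c * (size M * size M)))
theorem4p1 = 3 , λ
  { {zero} _ _ _ ()
  ; {suc k} M _ nf _ → let open Construction M in
      G , refl , refl , refl , mk⇔ (complete nf) (sound nf) , λ p₁ γ p₂ →
          M⟨ p₁ , γ , p₂ ⟩ , normalForm⇒ompa M⟨ p₁ , γ , p₂ ⟩ (phase-normalForm nf p₁ γ p₂)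
        , phase-normalForm nf p₁ γ p₂ , phase-language p₁ γ p₂ , size-phase p₁ γ p₂ }
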